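{- For $n\ge1$ let $\mathcal{T}'_n\subseteq\mathcal{T}_n$ be the set of trees whose root has exactly one child, and let $R_n(t)=\sum_{T\in\mathcal{T}'_n}t^{\operatorname{cdes}(T)-1}$. Then $$\sum_{n\ge1}R_n(t)\frac{z^n}{n!}=z\,\overline{Q}(t,z),$$ where $\overline{Q}(t,z)=\sum_{n\ge0}\sum_{\pi\in\overline{\mathcal{Q}}_n}t^{\operatorname{des}(\pi)}\frac{z^n}{n!}$.
   Context: For a sequence $\pi=\pi_1\cdots\pi_r$ of positive integers, $i\in\{1,\dots,r\}$ is a descent if $\pi_i>\pi_{i+1}$ or $i=r$; $\operatorname{des}(\pi)$ is the number of descents. The number of cyclic descents is $\operatorname{cdes}(\pi)=|\{i\in[r]:\pi_i>\pi_{i+1}\}|$ with $\pi_{r+1}:=\pi_1$. $\overline{\mathcal{Q}}_n$ is the set of quasi-Stirling permutations: permutations $\pi_1\cdots\pi_{2n}$ of $\{1,1,\dots,n,n\}$ with no $i<j<k<\ell$ such that $\pi_i=\pi_k$ and $\pi_j=\pi_\ell$ ($\overline{\mathcal{Q}}_0$ contains only the empty permutation). $\mathcal{T}_n$ is the set of plane (ordered) rooted trees with $n$ edges whose edges are labeled bijectively by $\{1,\dots,n\}$. For a vertex $v$ with child-edge labels $a_1,\dots,a_d$ from left to right: if $v$ is not the root and its parent edge has label $\ell$, $\operatorname{cdes}(v)=\operatorname{cdes}(\ell a_1\cdots a_d)$; if $v$ is the root, $\operatorname{cdes}(v)=\operatorname{des}(a_1\cdots a_d)$. Then $\operatorname{cdes}(T)=\sum_v\operatorname{cdes}(v)$.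 -}

module Defs where

open import Data.Nat using (ℕ; zero; suc; _+_; _*_; _<ᵇ_; _≡ᵇ_)
open import Data.Bool using (Bool; true; false; if_then_else_; _∧_; not)
open import Data.List using (List; []; _∷_; _++_; map; length; upTo)
open import Data.Product using (_×_; _,_; proj₁)
open import Relation.Nullary.Decidable using (⌊_⌋)
import Data.Nat as ℕ

allB : {A : Set} → (A → Bool) → List A → Bool
allB p [] = true
allB p (x ∷ xs) = p x ∧ allB p xs

anyB : {A : Set} → (A → Bool) → List A → Bool
anyB p [] = false
anyB p (x ∷ xs) = if p x then true else anyB p xs

occ : ℕ → List ℕ → ℕ
occ i [] = 0
occ i (x ∷ xs) = (if i ≡ᵇ x then 1 else 0) + occ i xs

descentAt : ℕ → ℕ → ℕ
descentAt x y = if y <ᵇ x then 1 else 0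

-- des(π): i is a descent if π_i > π_{i+1} or i = r (the last position).
des : List ℕ → ℕ
des [] = 0
des (x ∷ []) = 1
des (x ∷ y ∷ r) = descentAt x y + des (y ∷ r)

adjDes : List ℕ → ℕ
adjDes [] = 0
adjDes (x ∷ []) = 0
adjDes (x ∷ y ∷ r) = descentAt x y + adjDes (y ∷ r)

cdesSeq : List ℕ → ℕ
cdesSeq [] = 0
cdesSeq (x ∷ xs) = adjDes ((x ∷ xs) ++ (x ∷ []))

-- Plane rooted trees with labelled edges.
-- A vertex is given by the ordered (left to right) list of its child edges,
-- each edge carrying its label and the subtree below it.

data PTree : Set where
  node : List (ℕ × PTree) → PTree

mutual
  edges : PTree → List ℕ
  edges (node cs) = edgesF cs

  edgesF : List (ℕ × PTree) → List ℕ
  edgesF [] = []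
  edgesF ((ℓ , t) ∷ cs) = ℓ ∷ edges t ++ edgesF cs

oneTo : ℕ → List ℕ
oneTo n = map suc (upTo n)

isLabelledTree : ℕ → PTree → Bool
isLabelledTree n t =
  (length (edges t) ≡ᵇ n) ∧ allB (λ i → occ i (edges t) ≡ᵇ 1) (oneTo n)

rootOneChild : PTree → Bool
rootOneChild (node cs) = length cs ≡ᵇ 1

mutual
  cdesF : List (ℕ × PTree) → ℕ
  cdesF [] = 0
  cdesF ((ℓ , t) ∷ cs) = cdesSub ℓ t + cdesF cs

  -- sum of cdes(v) over the vertices of a subtree whose root v has
  -- parent edge labelled ℓ: cdes(v) = cdes(ℓ a₁ ⋯ a_d)
  cdesSub : ℕ → PTree → ℕ
  cdesSub ℓ (node cs) = cdesSeq (ℓ ∷ map proj₁ cs) + cdesF cs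

cdesTree : PTree → ℕ
cdesTree (node cs) = des (map proj₁ cs) + cdesF cs

isSubseq : List ℕ → List ℕ → Bool
isSubseq [] ys = true
isSubseq (x ∷ xs) [] = false
isSubseq (x ∷ xs) (y ∷ ys) =
  if ⌊ x ℕ.≟ y ⌋ then isSubseq xs ys else isSubseq (x ∷ xs) ys

isDoubledPerm : ℕ → List ℕ → Bool
isDoubledPerm n π =
  (length π ≡ᵇ 2 * n) ∧ allB (λ i → occ i π ≡ᵇ 2) (oneTo n)

-- there are i<j<k<l with π_i = π_k and π_j = π_l, i.e. some word
-- a b a b (a, b entries of π) occurs as a subsequence of π
hasCrossing : List ℕ → Bool
hasCrossing π = anyB (λ a → anyB (λ b → isSubseq (a ∷ b ∷ a ∷ b ∷ []) π) π) π

isQuasiStirling : ℕ → List ℕ → Bool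
isQuasiStirling n π = isDoubledPerm n π ∧ not (hasCrossing π)

-- A tree of 𝒯′ₙ₊₁ is a root edge ℓ above a forest F.  Walking around F depth first and writing
-- each edge label on the way down and again on the way back gives a word w; this walk is a
-- bijection from forests with distinct labels onto the noncrossing words in which every letter
-- occurs twice, ℓ w ℓ is quasi-Stirling on [n+1], and cdes T − 1 is the number of adjacent
-- descents of ℓ w ℓ.  Relabelling x ↦ x − ℓ mod (n+1) turns w into a quasi-Stirling permutation
-- π of [n] and ℓ into the maximum n+1.  With h marking the letters above ℓ, the descent
-- indicator of an adjacent pair (x, y) changes by h y − h x, which telescopes along ℓ w ℓ, so
-- des π is the descent count of ℓ w ℓ.  Thus trees with cdes = k+1 are in bijection with pairs
-- (ℓ, π) with des π = k, i.e. [tᵏ] Rₙ₊₁ = (n+1) [tᵏ] Q̄ₙ, the coefficient form of the identity.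

module Submission where

open import Defs
open import Data.Bool using (Bool; true; false; if_then_else_; _∧_; not)
import Data.Bool.Properties as Bool
open import Data.Bool.Properties using (T-≡; ∧-conicalˡ; ∧-conicalʳ; not-injective)
open import Data.Nat using (ℕ; zero; suc; _+_; _*_; _∸_; _≤_; _<_; z≤n; s≤s; _<ᵇ_; _≡ᵇ_; _≟_; _≤?_; _!)
open import Data.Nat.Properties
open import Data.Nat.Induction using (<-wellFounded)
open import Data.Nat.ListAction using (sum)
open import Data.Nat.Tactic.RingSolver using (solve-∀)
open import Data.Fin using (Fin; toℕ; fromℕ<)
open import Data.Fin.Properties using (toℕ<n; fromℕ<-toℕ; toℕ-fromℕ<; *↔×)
open import Data.Fin.Permutation using (↔⇒≡)
open import Data.List using (List; []; _∷_; _++_; [_]; map; length; upTo)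
open import Data.List.Properties using (++-assoc; ++-identityʳ; length-++; ∷-injective; map-++; map-∘; map-id-local; length-map; length-upTo; upTo-∷ʳ)
open import Data.List.Membership.Propositional using (_∈_; _∉_)
open import Data.List.Membership.Propositional.Properties using (∈-map⁻; ∈-++⁺ˡ; ∈-++⁻; ∈-∃++)
open import Data.List.Relation.Unary.Any using (here; there)
open import Data.List.Relation.Unary.All using (tabulate)
open import Data.List.Relation.Binary.Sublist.Propositional using (_⊆_; []; _∷_; _∷ʳ_; ⊆-refl; ⊆-trans; minimum; from∈)
open import Data.List.Relation.Binary.Sublist.Propositional.Properties using (map⁺; Any-resp-⊆; ∷ˡ⁻; ++⁺; ++⁺ˡ; ++⁺ʳ)
open import Data.List.Relation.Binary.Disjoint.Propositional using (Disjoint)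
open import Data.Product using (Σ; ∃; ∃₂; _×_; _,_; proj₁; proj₂; uncurry)
open import Data.Product.Function.NonDependent.Propositional using (_×-↔_)
open import Data.Sum using (_⊎_; inj₁; inj₂)
open import Function using (_∘_)
open import Function.Bundles using (Equivalence; _↔_; mk↔ₛ′)
open import Function.Properties.Inverse using (↔-sym; ↔-trans; ↔-refl)
open import Induction.WellFounded using (Acc; acc)
open import Axiom.UniquenessOfIdentityProofs using (module Decidable⇒UIP)
open import Relation.Nullary using (¬_; Dec; yes; no; contradiction; _×-dec_)
open import Relation.Nullary.Decidable using (dec-true; dec-false)
open import Relation.Binary.PropositionalEquality hiding ([_])

occ-∷-≡ : ∀ {x} xs → occ x (x ∷ xs) ≡ suc (occ x xs)
occ-∷-≡ {x} xs = cong (λ b → (if b then 1 else 0) + occ x xs) (dec-true (x ≟ x) refl)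

occ-∷-≢ : ∀ {x y} xs → x ≢ y → occ x (y ∷ xs) ≡ occ x xs
occ-∷-≢ {x} {y} xs x≢y = cong (λ b → (if b then 1 else 0) + occ x xs) (dec-false (x ≟ y) x≢y)

occ-++ : ∀ x xs ys → occ x (xs ++ ys) ≡ occ x xs + occ x ys
occ-++ x [] ys = refl
occ-++ x (y ∷ xs) ys = trans (cong (_ +_) (occ-++ x xs ys)) (sym (+-assoc _ (occ x xs) (occ x ys)))

occ-pos⇒∈ : ∀ {x} xs → 0 < occ x xs → x ∈ xs
occ-pos⇒∈ {x} (y ∷ xs) pos with x ≟ y
... | yes refl = here refl
... | no x≢y = there (occ-pos⇒∈ xs (subst (0 <_) (occ-∷-≢ xs x≢y) pos))

∈⇒occ-pos : ∀ {x xs} → x ∈ xs → 0 < occ x xs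
∈⇒occ-pos {x} {_ ∷ xs} (here refl) = subst (0 <_) (sym (occ-∷-≡ xs)) (s≤s z≤n)
∈⇒occ-pos {x} {y ∷ xs} (there x∈xs) = ≤-trans (∈⇒occ-pos x∈xs) (m≤n+m (occ x xs) _)

∉⇒occ≡0 : ∀ {x} xs → x ∉ xs → occ x xs ≡ 0
∉⇒occ≡0 {x} xs x∉xs with occ x xs in eq
... | zero = refl
... | suc _ = contradiction (occ-pos⇒∈ xs (subst (0 <_) (sym eq) (s≤s z≤n))) x∉xs

occ≡0⇒∉ : ∀ {x xs} → occ x xs ≡ 0 → x ∉ xs
occ≡0⇒∉ occ≡0 x∈xs = <-irrefl (sym occ≡0) (∈⇒occ-pos x∈xs)

occ-singleton-comm : ∀ x y → occ x [ y ] ≡ occ y [ x ]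
occ-singleton-comm x y with x ≟ y
... | yes refl = refl
... | no x≢y = trans (occ-∷-≢ [] x≢y) (sym (occ-∷-≢ [] (x≢y ∘ sym)))

AtMostOnce : List ℕ → Set
AtMostOnce w = ∀ x → occ x w ≤ 1

AtMostOnce-++ˡ : ∀ xs ys → AtMostOnce (xs ++ ys) → AtMostOnce xs
AtMostOnce-++ˡ xs ys once x = ≤-trans (m≤m+n _ _) (subst (_≤ 1) (occ-++ x xs ys) (once x))

AtMostOnce-++ʳ : ∀ xs ys → AtMostOnce (xs ++ ys) → AtMostOnce ys
AtMostOnce-++ʳ xs ys once x = ≤-trans (m≤n+m _ _) (subst (_≤ 1) (occ-++ x xs ys) (once x))

AtMostOnce-++⇒Disjoint : ∀ xs ys → AtMostOnce (xs ++ ys) → Disjoint xs ys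
AtMostOnce-++⇒Disjoint xs ys once {x} (x∈xs , x∈ys) =
  <-irrefl refl (≤-trans (+-mono-≤ (∈⇒occ-pos x∈xs) (∈⇒occ-pos x∈ys)) (subst (_≤ 1) (occ-++ x xs ys) (once x)))

AtMostOnce-∷⇒∉ : ∀ x xs → AtMostOnce (x ∷ xs) → x ∉ xs
AtMostOnce-∷⇒∉ x xs once x∈xs = AtMostOnce-++⇒Disjoint [ x ] xs once (here refl , x∈xs)

InRange : ℕ → ℕ → Set
InRange N x = 1 ≤ x × x ≤ N

inRange? : ∀ N x → Dec (InRange N x)
inRange? N x = (1 ≤? x) ×-dec (x ≤? N)

oneTo-suc : ∀ N → oneTo (suc N) ≡ oneTo N ++ [ suc N ]
oneTo-suc N = trans (cong (map suc) (sym (upTo-∷ʳ N))) (map-++ suc (upTo N) [ N ])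

occ-oneTo-out : ∀ N {x} → ¬ InRange N x → occ x (oneTo N) ≡ 0
occ-oneTo-out zero _ = refl
occ-oneTo-out (suc N) {x} x∉ with x ≟ suc N
... | yes refl = contradiction (s≤s z≤n , ≤-refl) x∉
... | no x≢N+1 = begin
  occ x (oneTo (suc N))              ≡⟨ cong (occ x) (oneTo-suc N) ⟩
  occ x (oneTo N ++ [ suc N ])       ≡⟨ occ-++ x (oneTo N) _ ⟩
  occ x (oneTo N) + occ x [ suc N ]  ≡⟨ cong₂ _+_ (occ-oneTo-out N λ (1≤x , x≤N) → x∉ (1≤x , m≤n⇒m≤1+n x≤N)) (occ-∷-≢ [] x≢N+1) ⟩
  0                                  ∎
  where open ≡-Reasoning

occ-oneTo-in : ∀ N {x} → InRange N x → occ x (oneTo N) ≡ 1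
occ-oneTo-in zero (1≤x , x≤0) = contradiction (≤-trans 1≤x x≤0) λ ()
occ-oneTo-in (suc N) {x} (1≤x , x≤N+1) = begin
  occ x (oneTo (suc N))              ≡⟨ cong (occ x) (oneTo-suc N) ⟩
  occ x (oneTo N ++ [ suc N ])       ≡⟨ occ-++ x (oneTo N) _ ⟩
  occ x (oneTo N) + occ x [ suc N ]  ≡⟨ last (x ≟ suc N) ⟩
  1                                  ∎
  where
  open ≡-Reasoning
  last : Dec (x ≡ suc N) → occ x (oneTo N) + occ x [ suc N ] ≡ 1
  last (yes refl) = cong₂ _+_ (occ-oneTo-out N λ (_ , x≤N) → <-irrefl refl x≤N) (occ-∷-≡ {suc N} [])
  last (no x≢N+1) = cong₂ _+_ (occ-oneTo-in N (1≤x , ≤-pred (≤∧≢⇒< x≤N+1 x≢N+1))) (occ-∷-≢ [] x≢N+1)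

occ-oneTo-≤1 : ∀ N x → occ x (oneTo N) ≤ 1
occ-oneTo-≤1 N x with inRange? N x
... | yes x∈ = ≤-reflexive (occ-oneTo-in N x∈)
... | no x∉ = ≤-trans (≤-reflexive (occ-oneTo-out N x∉)) z≤n

length-oneTo : ∀ N → length (oneTo N) ≡ N
length-oneTo N = trans (length-map suc (upTo N)) (length-upTo N)

sumOcc : List ℕ → List ℕ → ℕ
sumOcc L w = sum (map (λ i → occ i w) L)

sumOcc-[] : ∀ L → sumOcc L [] ≡ 0
sumOcc-[] [] = refl
sumOcc-[] (i ∷ L) = sumOcc-[] L

sumOcc-∷ : ∀ L y w → sumOcc L (y ∷ w) ≡ occ y L + sumOcc L w
sumOcc-∷ [] y w = refl
sumOcc-∷ (i ∷ L) y w = begin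
  occ i ([ y ] ++ w) + sumOcc L (y ∷ w)            ≡⟨ cong₂ _+_ (occ-++ i [ y ] w) (sumOcc-∷ L y w) ⟩
  (occ i [ y ] + occ i w) + (occ y L + sumOcc L w)  ≡⟨ cong (λ a → (a + occ i w) + (occ y L + sumOcc L w)) (occ-singleton-comm i y) ⟩
  (occ y [ i ] + occ i w) + (occ y L + sumOcc L w)  ≡⟨ +-assoc-swap (occ y [ i ]) (occ i w) (occ y L) (sumOcc L w) ⟩
  (occ y [ i ] + occ y L) + (occ i w + sumOcc L w)  ≡⟨ cong (_+ (occ i w + sumOcc L w)) (sym (occ-++ y [ i ] L)) ⟩
  occ y (i ∷ L) + sumOcc (i ∷ L) w                  ∎
  where
  open ≡-Reasoning
  +-assoc-swap : ∀ a b c d → (a + b) + (c + d) ≡ (a + c) + (b + d)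
  +-assoc-swap = solve-∀

sumOcc-≤-length : ∀ L w → AtMostOnce L → sumOcc L w ≤ length w
sumOcc-≤-length L [] _ = ≤-reflexive (sumOcc-[] L)
sumOcc-≤-length L (y ∷ w) L-unique =
  subst (_≤ suc (length w)) (sym (sumOcc-∷ L y w)) (+-mono-≤ (L-unique y) (sumOcc-≤-length L w L-unique))

sumOcc-≡-length : ∀ L w → (∀ {y} → y ∈ w → occ y L ≡ 1) → sumOcc L w ≡ length w
sumOcc-≡-length L [] _ = sumOcc-[] L
sumOcc-≡-length L (y ∷ w) once =
  trans (sumOcc-∷ L y w) (cong₂ _+_ (once (here refl)) (sumOcc-≡-length L w (once ∘ there)))

sumOcc-const : ∀ L w c → (∀ {i} → i ∈ L → occ i w ≡ c) → sumOcc L w ≡ length L * c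
sumOcc-const [] w c _ = refl
sumOcc-const (i ∷ L) w c const = cong₂ _+_ (const (here refl)) (sumOcc-const L w c (const ∘ there))

≡ᵇ-true⇒≡ : ∀ {m n} → (m ≡ᵇ n) ≡ true → m ≡ n
≡ᵇ-true⇒≡ {m} {n} eq = ≡ᵇ⇒≡ m n (Equivalence.from T-≡ eq)

≡⇒≡ᵇ-true : ∀ {m n} → m ≡ n → (m ≡ᵇ n) ≡ true
≡⇒≡ᵇ-true {m} {n} eq = Equivalence.to T-≡ (≡⇒≡ᵇ m n eq)

allB⇒ : ∀ (p : ℕ → Bool) L → allB p L ≡ true → ∀ {i} → i ∈ L → p i ≡ true
allB⇒ p (x ∷ L) all (here refl) = ∧-conicalˡ (p x) _ all
allB⇒ p (x ∷ L) all (there i∈L) = allB⇒ p L (∧-conicalʳ (p x) _ all) i∈L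

allB⇐ : ∀ (p : ℕ → Bool) L → (∀ {i} → i ∈ L → p i ≡ true) → allB p L ≡ true
allB⇐ p [] _ = refl
allB⇐ p (x ∷ L) all = cong₂ _∧_ (all (here refl)) (allB⇐ p L (all ∘ there))

anyB≡false⇒ : ∀ (p : ℕ → Bool) L → anyB p L ≡ false → ∀ {i} → i ∈ L → p i ≡ false
anyB≡false⇒ p (x ∷ L) none i∈ with p x in px | i∈
... | false | here refl = px
... | false | there i∈L = anyB≡false⇒ p L none i∈L

anyB≡false⇐ : ∀ (p : ℕ → Bool) L → (∀ i → p i ≡ false) → anyB p L ≡ false
anyB≡false⇐ p [] _ = refl
anyB≡false⇐ p (x ∷ L) none rewrite none x = anyB≡false⇐ p L none

∈-oneTo⇒InRange : ∀ N {x} → x ∈ oneTo N → InRange N x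
∈-oneTo⇒InRange N {x} x∈ with inRange? N x
... | yes x∈range = x∈range
... | no x∉range = contradiction (subst (0 <_) (occ-oneTo-out N x∉range) (∈⇒occ-pos x∈)) λ ()

InRange⇒∈-oneTo : ∀ N {x} → InRange N x → x ∈ oneTo N
InRange⇒∈-oneTo N x∈range = occ-pos⇒∈ (oneTo N) (subst (0 <_) (sym (occ-oneTo-in N x∈range)) (s≤s z≤n))

record Counts (c N : ℕ) (w : List ℕ) : Set where
  field
    occ-inRange : ∀ {x} → InRange N x → occ x w ≡ c
    support     : ∀ {x} → x ∈ w → InRange N x

-- isLabelledTree N T and isDoubledPerm n π unfold to CountsSpec 1 N N (edges T) and
-- CountsSpec 2 n (2 * n) π.
CountsSpec : ℕ → ℕ → ℕ → List ℕ → Bool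
CountsSpec c N L w = (length w ≡ᵇ L) ∧ allB (λ i → occ i w ≡ᵇ c) (oneTo N)

sumOcc-oneTo : ∀ {c N} w → (∀ {x} → InRange N x → occ x w ≡ c) → sumOcc (oneTo N) w ≡ N * c
sumOcc-oneTo {c} {N} w occ-inRange = begin
  sumOcc (oneTo N) w      ≡⟨ sumOcc-const (oneTo N) w c (occ-inRange ∘ ∈-oneTo⇒InRange N) ⟩
  length (oneTo N) * c    ≡⟨ cong (_* c) (length-oneTo N) ⟩
  N * c                   ∎
  where open ≡-Reasoning

CountsSpec⇒Counts : ∀ c N L w → L ≡ N * c → CountsSpec c N L w ≡ true → Counts c N w
CountsSpec⇒Counts c N L w L≡Nc spec = cnt
  where
  length≡Nc : length w ≡ N * c
  length≡Nc = trans (≡ᵇ-true⇒≡ (∧-conicalˡ _ _ spec)) L≡Nc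
  occ-inRange : ∀ {x} → InRange N x → occ x w ≡ c
  occ-inRange x∈range =
    ≡ᵇ-true⇒≡ (allB⇒ _ (oneTo N) (∧-conicalʳ _ _ spec) (InRange⇒∈-oneTo N x∈range))
  cnt : Counts c N w
  cnt .Counts.occ-inRange = occ-inRange
  -- A letter outside [1, N] would make w longer than the N * c letters counted inside it.
  cnt .Counts.support {x} x∈w with inRange? N x
  ... | yes x∈range = x∈range
  ... | no x∉range = contradiction (∈⇒occ-pos x∈w) (≤⇒≯ (+-cancelʳ-≤ (N * c) (occ x w) 0 (begin
      occ x w + N * c                  ≡⟨ cong (occ x w +_) (sym (sumOcc-oneTo w occ-inRange)) ⟩
      sumOcc (x ∷ oneTo N) w           ≤⟨ sumOcc-≤-length (x ∷ oneTo N) w once ⟩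
      length w                         ≡⟨ length≡Nc ⟩
      N * c                            ∎)))
    where
    open ≤-Reasoning
    once : AtMostOnce (x ∷ oneTo N)
    once y with y ≟ x
    ... | yes refl = ≤-reflexive (trans (occ-∷-≡ (oneTo N)) (cong suc (occ-oneTo-out N x∉range)))
    ... | no y≢x = subst (_≤ 1) (sym (occ-∷-≢ (oneTo N) y≢x)) (occ-oneTo-≤1 N y)

Counts⇒CountsSpec : ∀ c N L w → L ≡ N * c → Counts c N w → CountsSpec c N L w ≡ true
Counts⇒CountsSpec c N L w L≡Nc cnt =
  cong₂ _∧_ (≡⇒≡ᵇ-true length≡L) (allB⇐ _ (oneTo N) (≡⇒≡ᵇ-true ∘ occ-inRange ∘ ∈-oneTo⇒InRange N))
  where
  open Counts cnt
  length≡L : length w ≡ L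
  length≡L = begin
    length w            ≡⟨ sumOcc-≡-length (oneTo N) w (occ-oneTo-in N ∘ support) ⟨
    sumOcc (oneTo N) w  ≡⟨ sumOcc-oneTo w occ-inRange ⟩
    N * c               ≡⟨ L≡Nc ⟨
    L                   ∎
    where open ≡-Reasoning

⊆-++⁻ : ∀ {s} (xs ys : List ℕ) → s ⊆ xs ++ ys → ∃₂ λ s₁ s₂ → s ≡ s₁ ++ s₂ × s₁ ⊆ xs × s₂ ⊆ ys
⊆-++⁻ [] ys p = [] , _ , refl , [] , p
⊆-++⁻ (x ∷ xs) ys (.x ∷ʳ p) with ⊆-++⁻ xs ys p
... | s₁ , s₂ , refl , p₁ , p₂ = s₁ , s₂ , refl , x ∷ʳ p₁ , p₂
⊆-++⁻ (x ∷ xs) ys (refl ∷ p) with ⊆-++⁻ xs ys p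
... | s₁ , s₂ , refl , p₁ , p₂ = x ∷ s₁ , s₂ , refl , refl ∷ p₁ , p₂

⊆-[_] : ∀ (x : ℕ) {s} → s ⊆ [ x ] → s ≡ [] ⊎ s ≡ [ x ]
⊆-[ x ] (.x ∷ʳ []) = inj₁ refl
⊆-[ x ] (refl ∷ []) = inj₂ refl

isSubseq-complete : ∀ xs ys → xs ⊆ ys → isSubseq xs ys ≡ true
isSubseq-complete [] ys _ = refl
isSubseq-complete (x ∷ xs) (y ∷ ys) p with x ≟ y | p
... | yes refl | .y ∷ʳ p′ = isSubseq-complete xs ys (∷ˡ⁻ p′)
... | yes refl | refl ∷ p′ = isSubseq-complete xs ys p′
... | no _ | .y ∷ʳ p′ = isSubseq-complete (x ∷ xs) ys p′
... | no x≢y | refl ∷ _ = contradiction refl x≢y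

isSubseq-sound : ∀ xs ys → isSubseq xs ys ≡ true → xs ⊆ ys
isSubseq-sound [] ys _ = minimum ys
isSubseq-sound (x ∷ xs) (y ∷ ys) sub with x ≟ y
... | yes refl = refl ∷ isSubseq-sound xs ys sub
... | no _ = y ∷ʳ isSubseq-sound (x ∷ xs) ys sub

abab : ℕ → ℕ → List ℕ
abab a b = a ∷ b ∷ a ∷ b ∷ []

NonCrossing : List ℕ → Set
NonCrossing w = ∀ a b → ¬ abab a b ⊆ w

hasCrossing≡false⇒NonCrossing : ∀ w → hasCrossing w ≡ false → NonCrossing w
hasCrossing≡false⇒NonCrossing w none a b p =
  contradiction (trans (sym (isSubseq-complete (abab a b) w p)) no-abab) λ ()
  where
  no-abab : isSubseq (abab a b) w ≡ false
  no-abab = anyB≡false⇒ _ w (anyB≡false⇒ _ w none (Any-resp-⊆ p (here refl))) (Any-resp-⊆ p (there (here refl)))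

NonCrossing⇒hasCrossing≡false : ∀ w → NonCrossing w → hasCrossing w ≡ false
NonCrossing⇒hasCrossing≡false w nc = anyB≡false⇐ _ w λ a → anyB≡false⇐ _ w λ b → no-abab a b
  where
  no-abab : ∀ a b → isSubseq (abab a b) w ≡ false
  no-abab a b with isSubseq (abab a b) w in sub
  ... | false = refl
  ... | true = contradiction (isSubseq-sound (abab a b) w sub) (nc a b)

NonCrossing-⊆ : ∀ {v w} → v ⊆ w → NonCrossing w → NonCrossing v
NonCrossing-⊆ v⊆w nc a b p = nc a b (⊆-trans p v⊆w)

NonCrossing-map : ∀ (f g : ℕ → ℕ) w → map g (map f w) ≡ w → NonCrossing w → NonCrossing (map f w)
NonCrossing-map f g w g∘f≡id nc a b p = nc (g a) (g b) (subst (map g (abab a b) ⊆_) g∘f≡id (map⁺ g p))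

NonCrossing-++ : ∀ (xs ys : List ℕ) → Disjoint xs ys → NonCrossing xs → NonCrossing ys → NonCrossing (xs ++ ys)
NonCrossing-++ xs ys disj ncxs ncys a b p with ⊆-++⁻ xs ys p
... | [] , _ , refl , _ , p₂ = ncys a b p₂
... | _ ∷ [] , _ , refl , p₁ , p₂ = disj (Any-resp-⊆ p₁ (here refl) , Any-resp-⊆ p₂ (there (here refl)))
... | _ ∷ _ ∷ [] , _ , refl , p₁ , p₂ = disj (Any-resp-⊆ p₁ (here refl) , Any-resp-⊆ p₂ (here refl))
... | _ ∷ _ ∷ _ ∷ [] , _ , refl , p₁ , p₂ = disj (Any-resp-⊆ p₁ (there (here refl)) , Any-resp-⊆ p₂ (here refl))
... | _ ∷ _ ∷ _ ∷ _ ∷ [] , [] , refl , p₁ , _ = ncxs a b p₁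

NonCrossing-∷ʳ : ∀ {x} w → x ∉ w → NonCrossing w → NonCrossing (w ++ [ x ])
NonCrossing-∷ʳ {x} w x∉w nc a b p with ⊆-++⁻ w [ x ] p
... | s₁ , s₂ , eq , p₁ , p₂ with ⊆-[ x ] p₂
... | inj₁ refl = nc a b (subst (_⊆ w) (trans (sym (++-identityʳ s₁)) (sym eq)) p₁)
... | inj₂ refl = x∉w (Any-resp-⊆ p₁ (b∈ s₁ eq))
  where
  b∈ : ∀ s₁ → abab a b ≡ s₁ ++ [ x ] → x ∈ s₁
  b∈ (_ ∷ _ ∷ _ ∷ []) refl = there (here refl)
  b∈ (_ ∷ _ ∷ _ ∷ _ ∷ []) ()
  b∈ (_ ∷ _ ∷ _ ∷ _ ∷ _ ∷ _) ()

wrap : ℕ → List ℕ → List ℕ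
wrap ℓ w = ℓ ∷ w ++ [ ℓ ]

NonCrossing-wrap : ∀ {x} w → x ∉ w → NonCrossing w → NonCrossing (wrap x w)
NonCrossing-wrap w x∉w nc a b (_ ∷ʳ p) = NonCrossing-∷ʳ w x∉w nc a b p
NonCrossing-wrap {x} w x∉w nc .x b (refl ∷ p) with ⊆-++⁻ w [ x ] p
... | s₁ , s₂ , eq , p₁ , p₂ = x∉w (Any-resp-⊆ p₁ (x∈ s₁ s₂ eq (⊆-[ x ] p₂)))
  where
  x∈ : ∀ s₁ s₂ → b ∷ x ∷ b ∷ [] ≡ s₁ ++ s₂ → s₂ ≡ [] ⊎ s₂ ≡ [ x ] → x ∈ s₁
  x∈ (_ ∷ _ ∷ _ ∷ []) _ refl (inj₁ refl) = there (here refl)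
  x∈ (_ ∷ _ ∷ []) _ refl (inj₂ refl) = there (here refl)
  x∈ (_ ∷ _ ∷ _ ∷ []) _ () (inj₂ refl)
  x∈ (_ ∷ _ ∷ _ ∷ _ ∷ _) _ () (inj₂ refl)

dfsWord : List (ℕ × PTree) → List ℕ
dfsWord [] = []
dfsWord ((ℓ , node ds) ∷ cs) = ℓ ∷ dfsWord ds ++ ℓ ∷ dfsWord cs

labels : List (ℕ × PTree) → List ℕ
labels = map proj₁

occ-dfsWord : ∀ x cs → occ x (dfsWord cs) ≡ 2 * occ x (edgesF cs)
occ-dfsWord x [] = refl
occ-dfsWord x ((ℓ , node ds) ∷ cs) = begin
  occ x (ℓ ∷ dfsWord ds ++ ℓ ∷ dfsWord cs)                  ≡⟨ occ-++ x (ℓ ∷ dfsWord ds) (ℓ ∷ dfsWord cs) ⟩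
  occ x (ℓ ∷ dfsWord ds) + occ x (ℓ ∷ dfsWord cs)           ≡⟨ cong₂ _+_ (occ-++ x [ ℓ ] (dfsWord ds)) (occ-++ x [ ℓ ] (dfsWord cs)) ⟩
  (δ + occ x (dfsWord ds)) + (δ + occ x (dfsWord cs))       ≡⟨ cong₂ (λ p q → (δ + p) + (δ + q)) (occ-dfsWord x ds) (occ-dfsWord x cs) ⟩
  (δ + 2 * occ x (edgesF ds)) + (δ + 2 * occ x (edgesF cs)) ≡⟨ double δ (occ x (edgesF ds)) (occ x (edgesF cs)) ⟩
  2 * (δ + (occ x (edgesF ds) + occ x (edgesF cs)))          ≡⟨ cong (λ p → 2 * (δ + p)) (occ-++ x (edgesF ds) (edgesF cs)) ⟨
  2 * (δ + occ x (edgesF ds ++ edgesF cs))                   ≡⟨ cong (2 *_) (occ-++ x [ ℓ ] (edgesF ds ++ edgesF cs)) ⟨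
  2 * occ x (edgesF ((ℓ , node ds) ∷ cs))                    ∎
  where
  open ≡-Reasoning
  δ : ℕ
  δ = occ x [ ℓ ]
  double : ∀ d p q → (d + 2 * p) + (d + 2 * q) ≡ 2 * (d + (p + q))
  double = solve-∀

∈-dfsWord⁻ : ∀ {x} cs → x ∈ dfsWord cs → x ∈ edgesF cs
∈-dfsWord⁻ {x} cs x∈ =
  occ-pos⇒∈ (edgesF cs) (*-cancelˡ-< 2 0 _ (subst (0 <_) (occ-dfsWord x cs) (∈⇒occ-pos x∈)))

∉-dfsWord : ∀ {x} cs → x ∉ edgesF cs → x ∉ dfsWord cs
∉-dfsWord cs x∉ = x∉ ∘ ∈-dfsWord⁻ cs

module _ (ℓ : ℕ) (ds cs : List (ℕ × PTree)) (once : AtMostOnce (edgesF ((ℓ , node ds) ∷ cs))) where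

  AtMostOnce-children : AtMostOnce (edgesF ds)
  AtMostOnce-children = AtMostOnce-++ˡ (edgesF ds) (edgesF cs) (AtMostOnce-++ʳ [ ℓ ] (edgesF ds ++ edgesF cs) once)

  AtMostOnce-siblings : AtMostOnce (edgesF cs)
  AtMostOnce-siblings = AtMostOnce-++ʳ (edgesF ds) (edgesF cs) (AtMostOnce-++ʳ [ ℓ ] (edgesF ds ++ edgesF cs) once)

  AtMostOnce-root∉children : ℓ ∉ edgesF ds
  AtMostOnce-root∉children = AtMostOnce-∷⇒∉ ℓ _ once ∘ ∈-++⁺ˡ

dfsWord-NonCrossing : ∀ cs → AtMostOnce (edgesF cs) → NonCrossing (dfsWord cs)
dfsWord-NonCrossing [] _ a b ()
dfsWord-NonCrossing ((ℓ , node ds) ∷ cs) once =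
  subst NonCrossing (++-assoc (ℓ ∷ dfsWord ds) [ ℓ ] (dfsWord cs))
    (NonCrossing-++ (wrap ℓ (dfsWord ds)) (dfsWord cs) disjoint
      (NonCrossing-wrap (dfsWord ds) (∉-dfsWord ds (AtMostOnce-root∉children ℓ ds cs once))
        (dfsWord-NonCrossing ds (AtMostOnce-children ℓ ds cs once)))
      (dfsWord-NonCrossing cs (AtMostOnce-siblings ℓ ds cs once)))
  where
  toEdges : ∀ {x} → x ∈ wrap ℓ (dfsWord ds) → x ∈ ℓ ∷ edgesF ds
  toEdges (here refl) = here refl
  toEdges (there x∈) with ∈-++⁻ (dfsWord ds) x∈
  ... | inj₁ x∈ds = there (∈-dfsWord⁻ ds x∈ds)
  ... | inj₂ (here refl) = here refl
  disjoint : Disjoint (wrap ℓ (dfsWord ds)) (dfsWord cs)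
  disjoint (x∈tree , x∈cs) =
    AtMostOnce-++⇒Disjoint (ℓ ∷ edgesF ds) (edgesF cs) once (toEdges x∈tree , ∈-dfsWord⁻ cs x∈cs)

∉-++-∷-injective : ∀ {a : ℕ} u u′ {v v′} → a ∉ u → a ∉ u′ → u ++ a ∷ v ≡ u′ ++ a ∷ v′ → u ≡ u′ × v ≡ v′
∉-++-∷-injective [] [] _ _ eq = refl , proj₂ (∷-injective eq)
∉-++-∷-injective [] (x ∷ u′) _ a∉u′ eq = contradiction (here (proj₁ (∷-injective eq))) a∉u′
∉-++-∷-injective (x ∷ u) [] a∉u _ eq = contradiction (here (sym (proj₁ (∷-injective eq)))) a∉u
∉-++-∷-injective (x ∷ u) (x′ ∷ u′) a∉u a∉u′ eq with ∷-injective eq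
... | refl , eq′ with ∉-++-∷-injective u u′ (a∉u ∘ there) (a∉u′ ∘ there) eq′
... | refl , refl = refl , refl

dfsWord-injective : ∀ {cs cs′} → AtMostOnce (edgesF cs) → dfsWord cs ≡ dfsWord cs′ → cs ≡ cs′
dfsWord-injective {cs} {cs′} once eq = go cs cs′ once once′ eq
  where
  once′ : AtMostOnce (edgesF cs′)
  once′ x = subst (_≤ 1) (*-cancelˡ-≡ _ _ 2 (begin
    2 * occ x (edgesF cs)   ≡⟨ occ-dfsWord x cs ⟨
    occ x (dfsWord cs)      ≡⟨ cong (occ x) eq ⟩
    occ x (dfsWord cs′)     ≡⟨ occ-dfsWord x cs′ ⟩
    2 * occ x (edgesF cs′)  ∎)) (once x)
    where open ≡-Reasoning
  go : ∀ cs cs′ → AtMostOnce (edgesF cs) → AtMostOnce (edgesF cs′) → dfsWord cs ≡ dfsWord cs′ → cs ≡ cs′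
  go [] [] _ _ _ = refl
  go [] ((_ , node _) ∷ _) _ _ ()
  go ((_ , node _) ∷ _) [] _ _ ()
  go ((ℓ , node ds) ∷ cs) ((ℓ′ , node ds′) ∷ cs′) once once′ eq with ∷-injective eq
  ... | refl , eq′ with ∉-++-∷-injective (dfsWord ds) (dfsWord ds′)
                          (∉-dfsWord ds (AtMostOnce-root∉children ℓ ds cs once))
                          (∉-dfsWord ds′ (AtMostOnce-root∉children ℓ ds′ cs′ once′)) eq′
  ... | eq-ds , eq-cs
    rewrite go ds ds′ (AtMostOnce-children ℓ ds cs once) (AtMostOnce-children ℓ ds′ cs′ once′) eq-ds
          | go cs cs′ (AtMostOnce-siblings ℓ ds cs once) (AtMostOnce-siblings ℓ ds′ cs′ once′) eq-cs = refl

ZeroOrTwo : ℕ → Set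
ZeroOrTwo p = p ≡ 0 ⊎ p ≡ 2

ZeroOrTwo-+⁻ : ∀ p q → ZeroOrTwo (p + q) → ¬ (0 < p × 0 < q) → ZeroOrTwo p × ZeroOrTwo q
ZeroOrTwo-+⁻ zero q q∈ _ = inj₁ refl , q∈
ZeroOrTwo-+⁻ (suc p) zero p+0∈ _ = subst ZeroOrTwo (+-identityʳ (suc p)) p+0∈ , inj₁ refl
ZeroOrTwo-+⁻ (suc p) (suc q) _ not-both = contradiction (s≤s z≤n , s≤s z≤n) not-both

Doubled : List ℕ → Set
Doubled w = ∀ x → ZeroOrTwo (occ x w)

Doubled-∷⇒occ≡1 : ∀ a r → Doubled (a ∷ r) → occ a r ≡ 1
Doubled-∷⇒occ≡1 a r dbl with dbl a
... | inj₁ occ≡0 = contradiction (trans (sym (occ-∷-≡ r)) occ≡0) λ ()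
... | inj₂ occ≡2 = suc-injective (trans (sym (occ-∷-≡ r)) occ≡2)

Doubled-split : ∀ a r → Doubled (a ∷ r) → NonCrossing (a ∷ r) →
                ∃₂ λ u v → r ≡ u ++ a ∷ v × Doubled u × Doubled v
Doubled-split a r dbl nc with ∈-∃++ (occ-pos⇒∈ r (≤-reflexive (sym (Doubled-∷⇒occ≡1 a r dbl))))
... | u , v , refl = u , v , refl , proj₁ ∘ split , proj₂ ∘ split
  where
  occ-w : ∀ x → occ x (a ∷ u ++ a ∷ v) ≡ 2 * occ x [ a ] + (occ x u + occ x v)
  occ-w x = begin
    occ x (a ∷ u ++ a ∷ v)                            ≡⟨ occ-++ x (a ∷ u) (a ∷ v) ⟩
    occ x (a ∷ u) + occ x (a ∷ v)                     ≡⟨ cong₂ _+_ (occ-++ x [ a ] u) (occ-++ x [ a ] v) ⟩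
    (occ x [ a ] + occ x u) + (occ x [ a ] + occ x v) ≡⟨ regroup (occ x [ a ]) (occ x u) (occ x v) ⟩
    2 * occ x [ a ] + (occ x u + occ x v)             ∎
    where
    open ≡-Reasoning
    regroup : ∀ d p q → (d + p) + (d + q) ≡ 2 * d + (p + q)
    regroup = solve-∀
  split : ∀ x → ZeroOrTwo (occ x u) × ZeroOrTwo (occ x v)
  split x with x ≟ a | subst ZeroOrTwo (occ-w x) (dbl x)
  ... | yes refl | dbl-x rewrite occ-∷-≡ {x} [] with dbl-x
  ...   | inj₁ ()
  ...   | inj₂ occ≡2 = inj₁ (m+n≡0⇒m≡0 _ both≡0) , inj₁ (m+n≡0⇒n≡0 (occ x u) both≡0)
    where
    both≡0 : occ x u + occ x v ≡ 0
    both≡0 = +-cancelˡ-≡ 2 _ 0 occ≡2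
  split x | no x≢a | dbl-x rewrite occ-∷-≢ [] x≢a = ZeroOrTwo-+⁻ (occ x u) (occ x v) dbl-x
    λ (x∈u , x∈v) → nc a x (refl ∷ ++⁺ (from∈ (occ-pos⇒∈ u x∈u)) (refl ∷ from∈ (occ-pos⇒∈ v x∈v)))

module _ (a : ℕ) (u v : List ℕ) where

  wrapped-left-shorter : length u < length (a ∷ u ++ a ∷ v)
  wrapped-left-shorter = s≤s (≤-trans (m≤m+n _ _) (≤-reflexive (sym (length-++ u))))

  wrapped-right-shorter : length v < length (a ∷ u ++ a ∷ v)
  wrapped-right-shorter = s≤s (≤-trans (n≤1+n _) (≤-trans (m≤n+m _ _) (≤-reflexive (sym (length-++ u)))))

  wrapped-left-⊆ : u ⊆ a ∷ u ++ a ∷ v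
  wrapped-left-⊆ = a ∷ʳ ++⁺ʳ (a ∷ v) ⊆-refl

  wrapped-right-⊆ : v ⊆ a ∷ u ++ a ∷ v
  wrapped-right-⊆ = a ∷ʳ ++⁺ˡ u (a ∷ʳ ⊆-refl)

dfsWord-surjective : ∀ w → Doubled w → NonCrossing w → ∃ λ cs → dfsWord cs ≡ w
dfsWord-surjective w = go w (<-wellFounded (length w))
  where
  go : ∀ w → Acc _<_ (length w) → Doubled w → NonCrossing w → ∃ λ cs → dfsWord cs ≡ w
  go [] _ _ _ = [] , refl
  go (a ∷ r) (acc rec) dbl nc with Doubled-split a r dbl nc
  ... | u , v , refl , dbl-u , dbl-v
    with go u (rec (wrapped-left-shorter a u v)) dbl-u (NonCrossing-⊆ (wrapped-left-⊆ a u v) nc)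
       | go v (rec (wrapped-right-shorter a u v)) dbl-v (NonCrossing-⊆ (wrapped-right-⊆ a u v) nc)
  ... | ds , refl | cs , refl = (a , node ds) ∷ cs , refl

adjDes-++-∷ : ∀ u a v → adjDes (u ++ a ∷ v) ≡ adjDes (u ++ [ a ]) + adjDes (a ∷ v)
adjDes-++-∷ [] a v = refl
adjDes-++-∷ (x ∷ []) a v = cong (_+ adjDes (a ∷ v)) (sym (+-identityʳ (descentAt x a)))
adjDes-++-∷ (x ∷ y ∷ u) a v =
  trans (cong (descentAt x y +_) (adjDes-++-∷ (y ∷ u) a v)) (sym (+-assoc (descentAt x y) _ _))

adjDes-dfsWord : ∀ x y ds → adjDes (x ∷ dfsWord ds ++ [ y ]) ≡ adjDes (x ∷ labels ds ++ [ y ]) + cdesF ds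
adjDes-dfsWord x y [] = sym (+-identityʳ _)
adjDes-dfsWord x y ((a , node es) ∷ ds) = begin
  adjDes (x ∷ (a ∷ dfsWord es ++ a ∷ dfsWord ds) ++ [ y ])
    ≡⟨ cong (λ w → adjDes (x ∷ a ∷ w)) (++-assoc (dfsWord es) (a ∷ dfsWord ds) [ y ]) ⟩
  adjDes ((x ∷ a ∷ dfsWord es) ++ a ∷ (dfsWord ds ++ [ y ]))
    ≡⟨ adjDes-++-∷ (x ∷ a ∷ dfsWord es) a (dfsWord ds ++ [ y ]) ⟩
  descentAt x a + adjDes (a ∷ dfsWord es ++ [ a ]) + adjDes (a ∷ dfsWord ds ++ [ y ])
    ≡⟨ cong₂ (λ p q → descentAt x a + p + q) (adjDes-dfsWord a a es) (adjDes-dfsWord a y ds) ⟩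
  descentAt x a + (adjDes (a ∷ labels es ++ [ a ]) + cdesF es) + (adjDes (a ∷ labels ds ++ [ y ]) + cdesF ds)
    ≡⟨ regroup (descentAt x a) (adjDes (a ∷ labels es ++ [ a ])) (cdesF es) _ _ ⟩
  adjDes (x ∷ labels ((a , node es) ∷ ds) ++ [ y ]) + cdesF ((a , node es) ∷ ds)
    ∎
  where
  open ≡-Reasoning
  regroup : ∀ d s e t f → d + (s + e) + (t + f) ≡ d + t + (s + e + f)
  regroup = solve-∀

planted : ℕ → List (ℕ × PTree) → PTree
planted ℓ ds = node [ (ℓ , node ds) ]

cdesTree-planted : ∀ ℓ ds → cdesTree (planted ℓ ds) ≡ suc (adjDes (dfsWord [ (ℓ , node ds) ]))
cdesTree-planted ℓ ds = cong suc (trans (+-identityʳ _) (sym (adjDes-dfsWord ℓ ℓ ds)))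

record QuasiStirling (n : ℕ) (π : List ℕ) : Set where
  field
    counts      : Counts 2 n π
    nonCrossing : NonCrossing π

occ-wrap-≡ : ∀ ℓ w → occ ℓ (wrap ℓ w) ≡ 2 + occ ℓ w
occ-wrap-≡ ℓ w = trans (occ-∷-≡ (w ++ [ ℓ ])) (cong suc (trans (occ-++ ℓ w [ ℓ ]) (trans (cong (occ ℓ w +_) (occ-∷-≡ {ℓ} [])) (+-comm (occ ℓ w) 1))))

occ-wrap-≢ : ∀ {x ℓ} w → x ≢ ℓ → occ x (wrap ℓ w) ≡ occ x w
occ-wrap-≢ {x} {ℓ} w x≢ℓ = trans (occ-∷-≢ (w ++ [ ℓ ]) x≢ℓ) (trans (occ-++ x w [ ℓ ]) (trans (cong (occ x w +_) (occ-∷-≢ [] x≢ℓ)) (+-identityʳ (occ x w))))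

∈-wrap : ∀ {x ℓ} w → x ∈ w → x ∈ wrap ℓ w
∈-wrap w x∈w = there (∈-++⁺ˡ x∈w)

module WrappedQuasiStirling {N ℓ w} (ℓ∈range : InRange N ℓ) (qs : QuasiStirling N (wrap ℓ w)) where
  open QuasiStirling qs
  open Counts counts

  ℓ∉ : ℓ ∉ w
  ℓ∉ = occ≡0⇒∉ (+-cancelˡ-≡ 2 _ 0 (trans (sym (occ-wrap-≡ ℓ w)) (occ-inRange ℓ∈range)))

  support-w : ∀ {x} → x ∈ w → InRange N x × x ≢ ℓ
  support-w x∈w = support (∈-wrap w x∈w) , λ { refl → ℓ∉ x∈w }

  occ-w : ∀ {x} → InRange N x → x ≢ ℓ → occ x w ≡ 2
  occ-w x∈range x≢ℓ = trans (sym (occ-wrap-≢ w x≢ℓ)) (occ-inRange x∈range)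

  doubled : Doubled w
  doubled x with x ≟ ℓ
  ... | yes refl = inj₁ (∉⇒occ≡0 w ℓ∉)
  ... | no x≢ℓ with inRange? N x
  ...   | yes x∈range = inj₂ (occ-w x∈range x≢ℓ)
  ...   | no x∉range = inj₁ (∉⇒occ≡0 w (x∉range ∘ proj₁ ∘ support-w))

  nonCrossing-w : NonCrossing w
  nonCrossing-w = NonCrossing-⊆ (ℓ ∷ʳ ++⁺ʳ [ ℓ ] ⊆-refl) nonCrossing

descentAt-> : ∀ {x y} → y < x → descentAt x y ≡ 1
descentAt-> {x} {y} y<x = cong (λ b → if b then 1 else 0) (Equivalence.to T-≡ (<⇒<ᵇ y<x))

descentAt-≤ : ∀ {x y} → x ≤ y → descentAt x y ≡ 0
descentAt-≤ {x} {y} x≤y with y <ᵇ x in y<ᵇx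
... | false = refl
... | true = contradiction x≤y (<⇒≱ (<ᵇ⇒< y x (Equivalence.from T-≡ y<ᵇx)))

descentAt-+ˡ : ∀ c a b → descentAt (c + a) (c + b) ≡ descentAt a b
descentAt-+ˡ zero a b = refl
descentAt-+ˡ (suc c) a b = descentAt-+ˡ c a b

descentAt-+ʳ : ∀ c a b → descentAt (a + c) (b + c) ≡ descentAt a b
descentAt-+ʳ c a b = trans (cong₂ descentAt (+-comm a c) (+-comm b c)) (descentAt-+ˡ c a b)

des≡suc-adjDes : ∀ a r → des (a ∷ r) ≡ suc (adjDes (a ∷ r))
des≡suc-adjDes a [] = refl
des≡suc-adjDes a (b ∷ r) = trans (cong (descentAt a b +_) (des≡suc-adjDes b r)) (+-suc _ _)

adjDes-∷ʳ-max : ∀ {N} v → v ≢ [] → (∀ {z} → z ∈ v → z < N) → adjDes (v ++ [ N ]) ≡ adjDes v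
adjDes-∷ʳ-max [] v≢[] _ = contradiction refl v≢[]
adjDes-∷ʳ-max (a ∷ []) _ <N = cong (_+ 0) (descentAt-≤ (<⇒≤ (<N (here refl))))
adjDes-∷ʳ-max (a ∷ b ∷ v) _ <N = cong (descentAt a b +_) (adjDes-∷ʳ-max (b ∷ v) (λ ()) (<N ∘ there))

adjDes-wrap-max : ∀ N v → (∀ {z} → z ∈ v → z < N) → adjDes (wrap N v) ≡ des v
adjDes-wrap-max N [] _ = cong (_+ 0) (descentAt-≤ (≤-refl {N}))
adjDes-wrap-max N (a ∷ v) <N = begin
  descentAt N a + adjDes ((a ∷ v) ++ [ N ])  ≡⟨ cong₂ _+_ (descentAt-> (<N (here refl))) (adjDes-∷ʳ-max (a ∷ v) (λ ()) <N) ⟩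
  suc (adjDes (a ∷ v))                       ≡⟨ des≡suc-adjDes a v ⟨
  des (a ∷ v)                                ∎
  where open ≡-Reasoning

module _ (f g : ℕ → ℕ) where

  occ-map-inverse : ∀ w {x} → (∀ {z} → z ∈ w → g (f z) ≡ z) → g (f x) ≡ x → occ (f x) (map f w) ≡ occ x w
  occ-map-inverse [] _ _ = refl
  occ-map-inverse (z ∷ w) {x} inv inv-x with x ≟ z
  ... | yes refl = trans (occ-∷-≡ (map f w)) (trans (cong suc (occ-map-inverse w (inv ∘ there) inv-x)) (sym (occ-∷-≡ w)))
  ... | no x≢z = trans (occ-∷-≢ (map f w) fx≢fz) (trans (occ-map-inverse w (inv ∘ there) inv-x) (sym (occ-∷-≢ w x≢z)))
    where
    fx≢fz : f x ≢ f z
    fx≢fz fx≡fz = x≢z (trans (sym inv-x) (trans (cong g fx≡fz) (inv (here refl))))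

  map-inverse : ∀ w → (∀ {z} → z ∈ w → g (f z) ≡ z) → map g (map f w) ≡ w
  map-inverse w inv = trans (sym (map-∘ w)) (map-id-local (tabulate inv))

data Cut (ℓ x : ℕ) : Set where
  below : x ≤ ℓ → Cut ℓ x
  above : ∀ t → x ≡ ℓ + suc t → Cut ℓ x

cut : ∀ ℓ x → Cut ℓ x
cut zero zero = below z≤n
cut zero (suc x) = above x refl
cut (suc ℓ) zero = below z≤n
cut (suc ℓ) (suc x) with cut ℓ x
... | below x≤ℓ = below (s≤s x≤ℓ)
... | above t eq = above t (cong suc eq)

above⇒> : ∀ {ℓ t x} → x ≡ ℓ + suc t → ℓ < x
above⇒> {ℓ} refl = m<m+n ℓ (s≤s z≤n)

above-≤⇒ : ∀ {ℓ t x M} → x ≡ ℓ + suc t → x ≤ ℓ + M → suc t ≤ M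
above-≤⇒ {ℓ} refl = +-cancelˡ-≤ ℓ _ _

-- rotate x ≡ x − ℓ (mod N) with values in [1, N]: letters above ℓ move down by ℓ, the others
-- up by m = N − ℓ; in particular ℓ goes to N.
module Rotation (n j : ℕ) (j≤n : j ≤ n) where

  ℓ N m : ℕ
  ℓ = suc j
  N = suc n
  m = n ∸ j

  j+m≡n : j + m ≡ n
  j+m≡n = m+[n∸m]≡n j≤n

  m+j≡n : m + j ≡ n
  m+j≡n = trans (+-comm m j) j+m≡n

  ℓ+m≡N : ℓ + m ≡ N
  ℓ+m≡N = cong suc j+m≡n

  ≤N⇒≤ℓ+m : ∀ {x} → x ≤ N → x ≤ ℓ + m
  ≤N⇒≤ℓ+m {x} = subst (x ≤_) (sym ℓ+m≡N)

  ℓ∈range : InRange N ℓ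
  ℓ∈range = s≤s z≤n , s≤s j≤n

  Admissible : ℕ → Set
  Admissible x = InRange N x × x ≢ ℓ

  rotate : ℕ → ℕ
  rotate x with cut ℓ x
  ... | below _ = x + m
  ... | above t _ = suc t

  unrotate : ℕ → ℕ
  unrotate y with cut m y
  ... | below _ = y + ℓ
  ... | above t _ = suc t

  aboveℓ : ℕ → ℕ
  aboveℓ x with cut ℓ x
  ... | below _ = 0
  ... | above _ _ = 1

  rotate-inRange : ∀ {x} → Admissible x → InRange n (rotate x)
  rotate-inRange {x} ((1≤x , x≤N) , x≢ℓ) with cut ℓ x
  ... | below x≤ℓ = ≤-trans 1≤x (m≤m+n x m) , ≤-trans (+-monoˡ-≤ m (≤-pred (≤∧≢⇒< x≤ℓ x≢ℓ))) (≤-reflexive j+m≡n)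
  ... | above t eq = s≤s z≤n , ≤-trans (above-≤⇒ eq (≤N⇒≤ℓ+m x≤N)) (m∸n≤m n j)

  unrotate-rotate : ∀ {x} → Admissible x → unrotate (rotate x) ≡ x
  unrotate-rotate {x} ((1≤x , x≤N) , x≢ℓ) with cut ℓ x
  ... | above t eq with cut m (suc t)
  ...   | below _ = trans (+-comm (suc t) ℓ) (sym eq)
  ...   | above t′ eq′ = contradiction (above-≤⇒ eq (≤N⇒≤ℓ+m x≤N)) (<⇒≱ (above⇒> eq′))
  unrotate-rotate {x} ((1≤x , x≤N) , x≢ℓ) | below _ with cut m (x + m)
  ...   | below x+m≤m = contradiction (+-monoˡ-≤ m 1≤x) (<⇒≱ (s≤s x+m≤m))
  ...   | above t′ eq′ = sym (+-cancelʳ-≡ m x (suc t′) (trans eq′ (+-comm m (suc t′))))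

  unrotate-admissible : ∀ {y} → InRange n y → Admissible (unrotate y)
  unrotate-admissible {y} (1≤y , y≤n) with cut m y
  ... | below y≤m = (≤-trans 1≤y (m≤m+n y ℓ) , subst (y + ℓ ≤_) (trans (+-comm m ℓ) ℓ+m≡N) (+-monoˡ-≤ ℓ y≤m)) ,
                    λ y+ℓ≡ℓ → <⇒≢ (m<n+m ℓ 1≤y) (sym y+ℓ≡ℓ)
  ... | above t eq = (s≤s z≤n , ≤-trans (<⇒≤ t<ℓ) (s≤s j≤n)) , <⇒≢ t<ℓ
    where
    t<ℓ : suc t < ℓ
    t<ℓ = s≤s (above-≤⇒ eq (subst (y ≤_) (sym m+j≡n) y≤n))

  rotate-unrotate : ∀ {y} → InRange n y → rotate (unrotate y) ≡ y
  rotate-unrotate {y} (1≤y , y≤n) with cut m y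
  ... | below y≤m with cut ℓ (y + ℓ)
  ...   | below y+ℓ≤ℓ = contradiction (m<n+m ℓ 1≤y) (≤⇒≯ y+ℓ≤ℓ)
  ...   | above t eq = sym (+-cancelʳ-≡ ℓ y (suc t) (trans eq (+-comm ℓ (suc t))))
  rotate-unrotate {y} (1≤y , y≤n) | above t eq with cut ℓ (suc t)
  ...   | below _ = trans (+-comm (suc t) m) (sym eq)
  ...   | above t′ eq′ = contradiction (above-≤⇒ eq (subst (y ≤_) (sym m+j≡n) y≤n)) (<⇒≱ (<-trans (n<1+n j) (above⇒> eq′)))

  rotate-ℓ : rotate ℓ ≡ N
  rotate-ℓ with cut ℓ ℓ
  ... | below _ = ℓ+m≡N
  ... | above t eq = contradiction (above⇒> eq) (<-irrefl refl)

  descentAt-rotate : ∀ {x y} → InRange N x → InRange N y →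
                     descentAt (rotate x) (rotate y) + aboveℓ x ≡ descentAt x y + aboveℓ y
  descentAt-rotate {x} {y} (1≤x , x≤N) (1≤y , y≤N) with cut ℓ x | cut ℓ y
  ... | below _ | below _ = cong (_+ 0) (descentAt-+ʳ m x y)
  ... | above t refl | above s refl = cong (_+ 1) (sym (descentAt-+ˡ ℓ (suc t) (suc s)))
  ... | above t eq | below y≤ℓ =
    trans (cong (_+ 1) (descentAt-≤ (≤-trans (above-≤⇒ eq (≤N⇒≤ℓ+m x≤N)) (m≤n+m m y))))
          (cong (_+ 0) (sym (descentAt-> (≤-<-trans y≤ℓ (above⇒> eq)))))
  ... | below x≤ℓ | above s eq =
    trans (cong (_+ 0) (descentAt-> (<-≤-trans (s≤s (above-≤⇒ eq (≤N⇒≤ℓ+m y≤N))) (+-monoˡ-≤ m 1≤x))))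
          (cong (_+ 1) (sym (descentAt-≤ (≤-trans x≤ℓ (<⇒≤ (above⇒> eq))))))

  adjDes-rotate : ∀ x p y → (∀ {z} → z ∈ x ∷ p ++ [ y ] → InRange N z) →
                  adjDes (map rotate (x ∷ p ++ [ y ])) + aboveℓ x ≡ adjDes (x ∷ p ++ [ y ]) + aboveℓ y
  adjDes-rotate x [] y range = begin
    (descentAt (rotate x) (rotate y) + 0) + aboveℓ x  ≡⟨ cong (_+ aboveℓ x) (+-identityʳ _) ⟩
    descentAt (rotate x) (rotate y) + aboveℓ x        ≡⟨ descentAt-rotate (range (here refl)) (range (there (here refl))) ⟩
    descentAt x y + aboveℓ y                          ≡⟨ cong (_+ aboveℓ y) (+-identityʳ _) ⟨
    (descentAt x y + 0) + aboveℓ y                    ∎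
    where open ≡-Reasoning
  adjDes-rotate x (z ∷ p) y range = begin
    (descentAt (rotate x) (rotate z) + rest) + aboveℓ x   ≡⟨ swap (descentAt (rotate x) (rotate z)) rest (aboveℓ x) ⟩
    (descentAt (rotate x) (rotate z) + aboveℓ x) + rest   ≡⟨ cong (_+ rest) (descentAt-rotate (range (here refl)) (range (there (here refl)))) ⟩
    (descentAt x z + aboveℓ z) + rest                     ≡⟨ +-assoc (descentAt x z) (aboveℓ z) rest ⟩
    descentAt x z + (aboveℓ z + rest)                     ≡⟨ cong (descentAt x z +_) (+-comm (aboveℓ z) rest) ⟩
    descentAt x z + (rest + aboveℓ z)                     ≡⟨ cong (descentAt x z +_) (adjDes-rotate z p y (range ∘ there)) ⟩
    descentAt x z + (adjDes (z ∷ p ++ [ y ]) + aboveℓ y)  ≡⟨ +-assoc (descentAt x z) _ (aboveℓ y) ⟨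
    adjDes (x ∷ z ∷ p ++ [ y ]) + aboveℓ y                ∎
    where
    open ≡-Reasoning
    rest : ℕ
    rest = adjDes (map rotate (z ∷ p ++ [ y ]))
    swap : ∀ a b c → (a + b) + c ≡ (a + c) + b
    swap a b c = trans (+-assoc a b c) (trans (cong (a +_) (+-comm b c)) (sym (+-assoc a c b)))

  des-rotate : ∀ w → (∀ {z} → z ∈ w → Admissible z) → des (map rotate w) ≡ adjDes (wrap ℓ w)
  des-rotate w admissible = +-cancelʳ-≡ (aboveℓ ℓ) _ _ (begin
    des (map rotate w) + aboveℓ ℓ                    ≡⟨ cong (_+ aboveℓ ℓ) (adjDes-wrap-max N (map rotate w) <N) ⟨
    adjDes (wrap N (map rotate w)) + aboveℓ ℓ        ≡⟨ cong (λ w′ → adjDes w′ + aboveℓ ℓ) rotate-wrap ⟨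
    adjDes (map rotate (wrap ℓ w)) + aboveℓ ℓ        ≡⟨ adjDes-rotate ℓ w ℓ range ⟩
    adjDes (wrap ℓ w) + aboveℓ ℓ                     ∎)
    where
    open ≡-Reasoning
    <N : ∀ {z} → z ∈ map rotate w → z < N
    <N z∈ with ∈-map⁻ rotate z∈
    ... | x , x∈w , refl = s≤s (proj₂ (rotate-inRange (admissible x∈w)))
    rotate-wrap : map rotate (wrap ℓ w) ≡ wrap N (map rotate w)
    rotate-wrap = cong₂ _∷_ rotate-ℓ (trans (map-++ rotate w [ ℓ ]) (cong (λ x → map rotate w ++ [ x ]) rotate-ℓ))
    range : ∀ {z} → z ∈ wrap ℓ w → InRange N z
    range (here refl) = ℓ∈range
    range (there z∈) with ∈-++⁻ w z∈
    ... | inj₁ z∈w = proj₁ (admissible z∈w)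
    ... | inj₂ (here refl) = ℓ∈range

  module _ {w} (qs : QuasiStirling N (wrap ℓ w)) where
    open WrappedQuasiStirling ℓ∈range qs

    unrotate-rotate-word : map unrotate (map rotate w) ≡ w
    unrotate-rotate-word = map-inverse rotate unrotate w (unrotate-rotate ∘ support-w)

    rotate-QuasiStirling : QuasiStirling n (map rotate w)
    rotate-QuasiStirling .QuasiStirling.counts .Counts.occ-inRange {y} y∈range = begin
      occ y (map rotate w)                       ≡⟨ cong (λ z → occ z (map rotate w)) (rotate-unrotate y∈range) ⟨
      occ (rotate (unrotate y)) (map rotate w)   ≡⟨ occ-map-inverse rotate unrotate w (unrotate-rotate ∘ support-w) (unrotate-rotate admissible) ⟩
      occ (unrotate y) w                         ≡⟨ occ-w (proj₁ admissible) (proj₂ admissible) ⟩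
      2                                          ∎
      where
      open ≡-Reasoning
      admissible : Admissible (unrotate y)
      admissible = unrotate-admissible y∈range
    rotate-QuasiStirling .QuasiStirling.counts .Counts.support y∈ with ∈-map⁻ rotate y∈
    ... | x , x∈w , refl = rotate-inRange (support-w x∈w)
    rotate-QuasiStirling .QuasiStirling.nonCrossing =
      NonCrossing-map rotate unrotate w unrotate-rotate-word nonCrossing-w

    des-rotated : des (map rotate w) ≡ adjDes (wrap ℓ w)
    des-rotated = des-rotate w support-w

  module _ {π} (qs : QuasiStirling n π) where
    open QuasiStirling qs
    open Counts counts

    rotate-unrotate-word : map rotate (map unrotate π) ≡ π
    rotate-unrotate-word = map-inverse unrotate rotate π (rotate-unrotate ∘ support)

    ℓ∉unrotated : ℓ ∉ map unrotate π
    ℓ∉unrotated ℓ∈ with ∈-map⁻ unrotate ℓ∈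
    ... | y , y∈π , ℓ≡ = proj₂ (unrotate-admissible (support y∈π)) (sym ℓ≡)

    unrotate-QuasiStirling : QuasiStirling N (wrap ℓ (map unrotate π))
    unrotate-QuasiStirling .QuasiStirling.counts .Counts.occ-inRange {x} x∈range with x ≟ ℓ
    ... | yes refl = trans (occ-wrap-≡ ℓ (map unrotate π)) (cong (2 +_) (∉⇒occ≡0 _ ℓ∉unrotated))
    ... | no x≢ℓ = begin
      occ x (wrap ℓ (map unrotate π))               ≡⟨ occ-wrap-≢ (map unrotate π) x≢ℓ ⟩
      occ x (map unrotate π)                        ≡⟨ cong (λ z → occ z (map unrotate π)) (unrotate-rotate (x∈range , x≢ℓ)) ⟨
      occ (unrotate (rotate x)) (map unrotate π)    ≡⟨ occ-map-inverse unrotate rotate π (rotate-unrotate ∘ support) (rotate-unrotate (rotate-inRange (x∈range , x≢ℓ))) ⟩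
      occ (rotate x) π                              ≡⟨ occ-inRange (rotate-inRange (x∈range , x≢ℓ)) ⟩
      2                                             ∎
      where open ≡-Reasoning
    unrotate-QuasiStirling .QuasiStirling.counts .Counts.support (here refl) = ℓ∈range
    unrotate-QuasiStirling .QuasiStirling.counts .Counts.support (there x∈) with ∈-++⁻ (map unrotate π) x∈
    ... | inj₂ (here refl) = ℓ∈range
    ... | inj₁ x∈unrotated with ∈-map⁻ unrotate x∈unrotated
    ...   | y , y∈π , refl = proj₁ (unrotate-admissible (support y∈π))
    unrotate-QuasiStirling .QuasiStirling.nonCrossing =
      NonCrossing-wrap (map unrotate π) ℓ∉unrotated (NonCrossing-map unrotate rotate π rotate-unrotate-word nonCrossing)

    adjDes-unrotated : adjDes (wrap ℓ (map unrotate π)) ≡ des π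
    adjDes-unrotated = trans (sym (des-rotate (map unrotate π) admissible)) (cong des rotate-unrotate-word)
      where
      admissible : ∀ {z} → z ∈ map unrotate π → Admissible z
      admissible z∈ with ∈-map⁻ unrotate z∈
      ... | y , y∈π , refl = unrotate-admissible (support y∈π)

isQuasiStirling⇒QuasiStirling : ∀ n π → isQuasiStirling n π ≡ true → QuasiStirling n π
isQuasiStirling⇒QuasiStirling n π spec = record
  { counts = CountsSpec⇒Counts 2 n (2 * n) π (*-comm 2 n) (∧-conicalˡ _ _ spec)
  ; nonCrossing = hasCrossing≡false⇒NonCrossing π (not-injective (∧-conicalʳ _ _ spec))
  }

QuasiStirling⇒isQuasiStirling : ∀ n π → QuasiStirling n π → isQuasiStirling n π ≡ true
QuasiStirling⇒isQuasiStirling n π qs =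
  cong₂ _∧_ (Counts⇒CountsSpec 2 n (2 * n) π (*-comm 2 n) counts) (cong not (NonCrossing⇒hasCrossing≡false π nonCrossing))
  where open QuasiStirling qs

isLabelledTree⇒Counts : ∀ N T → isLabelledTree N T ≡ true → Counts 1 N (edges T)
isLabelledTree⇒Counts N T = CountsSpec⇒Counts 1 N N (edges T) (sym (*-identityʳ N))

Counts⇒isLabelledTree : ∀ N T → Counts 1 N (edges T) → isLabelledTree N T ≡ true
Counts⇒isLabelledTree N T = Counts⇒CountsSpec 1 N N (edges T) (sym (*-identityʳ N))

Counts-1⇒AtMostOnce : ∀ {N w} → Counts 1 N w → AtMostOnce w
Counts-1⇒AtMostOnce {N} {w} cnt x with inRange? N x
... | yes x∈range = ≤-reflexive (occ-inRange x∈range)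
  where open Counts cnt
... | no x∉range = ≤-trans (≤-reflexive (∉⇒occ≡0 w (x∉range ∘ support))) z≤n
  where open Counts cnt

∈-dfsWord⁺ : ∀ {x} cs → x ∈ edgesF cs → x ∈ dfsWord cs
∈-dfsWord⁺ {x} cs x∈ = occ-pos⇒∈ (dfsWord cs)
  (subst (0 <_) (sym (occ-dfsWord x cs)) (≤-trans (∈⇒occ-pos x∈) (m≤m+n _ _)))

dfsWord-QuasiStirling : ∀ {N} cs → Counts 1 N (edgesF cs) → QuasiStirling N (dfsWord cs)
dfsWord-QuasiStirling cs cnt .QuasiStirling.counts .Counts.occ-inRange {x} x∈range =
  trans (occ-dfsWord x cs) (cong (2 *_) (Counts.occ-inRange cnt x∈range))
dfsWord-QuasiStirling cs cnt .QuasiStirling.counts .Counts.support =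
  Counts.support cnt ∘ ∈-dfsWord⁻ cs
dfsWord-QuasiStirling cs cnt .QuasiStirling.nonCrossing =
  dfsWord-NonCrossing cs (Counts-1⇒AtMostOnce cnt)

QuasiStirling-dfsWord⇒Counts : ∀ {N} cs → QuasiStirling N (dfsWord cs) → Counts 1 N (edgesF cs)
QuasiStirling-dfsWord⇒Counts cs qs .Counts.occ-inRange {x} x∈range =
  *-cancelˡ-≡ _ 1 2 (trans (sym (occ-dfsWord x cs)) (Counts.occ-inRange (QuasiStirling.counts qs) x∈range))
QuasiStirling-dfsWord⇒Counts cs qs .Counts.support =
  Counts.support (QuasiStirling.counts qs) ∘ ∈-dfsWord⁺ cs

Σ-≡-by-witness : ∀ {A : Set} {b : A → Bool} {f : A → ℕ} {c} {s t : Σ A λ x → b x ≡ true × f x ≡ c} →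
                 proj₁ s ≡ proj₁ t → s ≡ t
Σ-≡-by-witness {s = x , p , q} {t = .x , p′ , q′} refl =
  cong₂ (λ p q → x , p , q) (Decidable⇒UIP.≡-irrelevant Bool._≟_ p p′) (≡-irrelevant q q′)

module _ {N : ℕ} (T : PTree) (spec : (isLabelledTree N T ∧ rootOneChild T) ≡ true) where

  spec-labelled : isLabelledTree N T ≡ true
  spec-labelled = ∧-conicalˡ (isLabelledTree N T) (rootOneChild T) spec

  spec-oneChild : rootOneChild T ≡ true
  spec-oneChild = ∧-conicalʳ (isLabelledTree N T) (rootOneChild T) spec

planted-shape : ∀ N T → (isLabelledTree N T ∧ rootOneChild T) ≡ true → ∃₂ λ j ds → T ≡ planted (suc j) ds
planted-shape N T@(node []) spec = contradiction (spec-oneChild {N} T spec) λ ()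
planted-shape N T@(node ((zero , node ds) ∷ [])) spec =
  contradiction (proj₁ (Counts.support (isLabelledTree⇒Counts N T (spec-labelled {N} T spec)) (here refl))) λ ()
planted-shape N (node ((suc j , node ds) ∷ [])) _ = j , ds , refl
planted-shape N T@(node (_ ∷ _ ∷ _)) spec = contradiction (spec-oneChild {N} T spec) λ ()

module PlantedTrees (n k : ℕ) where

  N : ℕ
  N = suc n

  Trees : Set
  Trees = Σ PTree λ T → (isLabelledTree N T ∧ rootOneChild T) ≡ true × cdesTree T ≡ suc k

  Perms : Set
  Perms = Σ (List ℕ) λ π → isQuasiStirling n π ≡ true × des π ≡ k

  module _ (j : ℕ) (j≤n : j ≤ n) where
    open Rotation n j j≤n hiding (N)

    unrotatedForest : ∀ {π} → QuasiStirling n π → ∃ λ ds → dfsWord ds ≡ map unrotate π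
    unrotatedForest qs = dfsWord-surjective _ doubled nonCrossing-w
      where open WrappedQuasiStirling ℓ∈range (unrotate-QuasiStirling qs)

    forest : ∀ π → isQuasiStirling n π ≡ true → List (ℕ × PTree)
    forest π spec = proj₁ (unrotatedForest (isQuasiStirling⇒QuasiStirling n π spec))

    dfsWord-forest : ∀ π spec → dfsWord (forest π spec) ≡ map unrotate π
    dfsWord-forest π spec = proj₂ (unrotatedForest (isQuasiStirling⇒QuasiStirling n π spec))

    plant : Perms → Trees
    plant (π , spec , des≡k) = planted ℓ ds , cong (_∧ true) labelled , cdes
      where
      qs : QuasiStirling n π
      qs = isQuasiStirling⇒QuasiStirling n π spec
      ds : List (ℕ × PTree)
      ds = forest π spec
      labelled : isLabelledTree N (planted ℓ ds) ≡ true
      labelled = Counts⇒isLabelledTree N (planted ℓ ds) (QuasiStirling-dfsWord⇒Counts [ (ℓ , node ds) ]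
        (subst (QuasiStirling N ∘ wrap ℓ) (sym (dfsWord-forest π spec)) (unrotate-QuasiStirling qs)))
      cdes : cdesTree (planted ℓ ds) ≡ suc k
      cdes = trans (cdesTree-planted ℓ ds)
        (cong suc (trans (cong (adjDes ∘ wrap ℓ) (dfsWord-forest π spec)) (trans (adjDes-unrotated qs) des≡k)))

  plantAt : Fin N → Perms → Trees
  plantAt i = plant (toℕ i) (≤-pred (toℕ<n i))

  module _ (j : ℕ) (ds : List (ℕ × PTree)) (spec : (isLabelledTree N (planted (suc j) ds) ∧ true) ≡ true) where

    plantedCounts : Counts 1 N (edgesF [ (suc j , node ds) ])
    plantedCounts = isLabelledTree⇒Counts N (planted (suc j) ds) (spec-labelled {N} (planted (suc j) ds) spec)

    root≤n : j ≤ n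
    root≤n = ≤-pred (proj₂ (Counts.support plantedCounts (here refl)))

    open Rotation n j root≤n hiding (N)

    plantedQuasiStirling : QuasiStirling N (wrap ℓ (dfsWord ds))
    plantedQuasiStirling = dfsWord-QuasiStirling [ (ℓ , node ds) ] plantedCounts

    uprootPlanted : cdesTree (planted ℓ ds) ≡ suc k → Fin N × Perms
    uprootPlanted cdes = fromℕ< (s≤s root≤n) , map rotate (dfsWord ds) , isQS , des≡k
      where
      isQS : isQuasiStirling n (map rotate (dfsWord ds)) ≡ true
      isQS = QuasiStirling⇒isQuasiStirling n _ (rotate-QuasiStirling plantedQuasiStirling)
      des≡k : des (map rotate (dfsWord ds)) ≡ k
      des≡k = trans (des-rotated plantedQuasiStirling) (suc-injective (trans (sym (cdesTree-planted ℓ ds)) cdes))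

    forest-rotated : ∀ {j′} → j′ ≡ j → (j′≤n : j′ ≤ n) → ∀ spec′ → forest j′ j′≤n (map rotate (dfsWord ds)) spec′ ≡ ds
    forest-rotated refl j′≤n spec′ =
      sym (dfsWord-injective once (sym (trans (dfsWord-forest j j′≤n _ spec′) (unrotate-rotate-word plantedQuasiStirling))))
      where
      once : AtMostOnce (edgesF ds)
      once = AtMostOnce-children ℓ ds [] (Counts-1⇒AtMostOnce plantedCounts)

  uproot : Trees → Fin N × Perms
  uproot (T , spec , cdes) with planted-shape N T spec
  ... | j , ds , refl = uprootPlanted j ds spec cdes

  uproot-plantAt : ∀ i perm → uproot (plantAt i perm) ≡ (i , perm)
  uproot-plantAt i (π , spec , des≡k) =
    cong₂ _,_ (fromℕ<-toℕ i _) (Σ-≡-by-witness (trans (cong (map rotate) (dfsWord-forest (toℕ i) j≤n π spec)) (rotate-unrotate-word qs)))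
    where
    j≤n : toℕ i ≤ n
    j≤n = ≤-pred (toℕ<n i)
    open Rotation n (toℕ i) j≤n hiding (N)
    qs : QuasiStirling n π
    qs = isQuasiStirling⇒QuasiStirling n π spec

  plantAt-uproot : ∀ tree → uncurry plantAt (uproot tree) ≡ tree
  plantAt-uproot (T , spec , cdes) = replant T spec cdes (planted-shape N T spec)
    where
    -- Matching on planted-shape with a helper rather than with-abstraction: the latter
    -- normalises the goal, which unfolds every proof inside uproot and exhausts memory.
    replant : ∀ T spec cdes → (∃₂ λ j ds → T ≡ planted (suc j) ds) →
              uncurry plantAt (uproot (T , spec , cdes)) ≡ (T , spec , cdes)
    replant _ spec cdes (j , ds , refl) =
      Σ-≡-by-witness (cong₂ (planted ∘ suc) toℕ≡j (forest-rotated j ds spec toℕ≡j _ _))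
      where
      toℕ≡j : toℕ (fromℕ< (s≤s (root≤n j ds spec))) ≡ j
      toℕ≡j = toℕ-fromℕ< (s≤s (root≤n j ds spec))

  Trees↔Fin×Perms : Trees ↔ (Fin N × Perms)
  Trees↔Fin×Perms = mk↔ₛ′ uproot (uncurry plantAt) (uncurry uproot-plantAt) plantAt-uproot

lemma2p4 : (n k m m' : ℕ)
    → (Fin m ↔ Σ PTree (λ T → (isLabelledTree (suc n) T ∧ rootOneChild T) ≡ true × cdesTree T ≡ suc k))
    → (Fin m' ↔ Σ (List ℕ) (λ π → isQuasiStirling n π ≡ true × des π ≡ k))
    → m * n ! ≡ m' * (suc n) !
lemma2p4 n k m m' Fin-m↔Trees Fin-m'↔Perms = begin
  m * n !             ≡⟨ cong (_* n !) m≡N*m′ ⟩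
  (suc n * m') * n !  ≡⟨ cong (_* n !) (*-comm (suc n) m') ⟩
  (m' * suc n) * n !  ≡⟨ *-assoc m' (suc n) (n !) ⟩
  m' * (suc n) !      ∎
  where
  open ≡-Reasoning
  open PlantedTrees n k
  m≡N*m′ : m ≡ suc n * m'
  m≡N*m′ = ↔⇒≡ (↔-trans Fin-m↔Trees (↔-trans Trees↔Fin×Perms (↔-trans (↔-refl ×-↔ ↔-sym Fin-m'↔Perms) (↔-sym *↔×))))
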